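{- Let $G$ be a group and $\pi=\{C_1,\dots,C_\ell\}$ a collection of $\ell$ distinct subsets of $G$, each of size $k$ and containing $e$, pairwise intersecting exactly in $\{e\}$ and satisfying the $T$-axiom. Let $AH$ be the automorphism group of the hypergraph $CH(G,\pi)$, and identify $G$ with the subgroup $\{\mathcal{L}_g: g\in G\}$ of $AH$. Then \[ N_{AH}(G)\cap\{\varphi\in AH:\varphi(e)=e\}\cong \mathrm{Aut}(G,\pi). \]
   Context: For $C\subseteq G$ and $g\in G$, $gC=\{gs:s\in C\}$. A collection $\pi$ of subsets of $G$, each containing $e$, satisfies the $T$-axiom if for every $C\in\pi$ and $s\in C$, $s^{ -1}C\in\pi$. The hypergraph $CH(G,\pi)$ has vertex set $G$ and hyperedge set $\{gC:g\in G,C\in\pi\}$; its automorphisms are permutations of $G$ mapping the set of hyperedges bijectively onto itself. $\mathcal{L}_g:G\to G$, $x\mapsto gx$ is left translation. $N_{AH}(G)$ is the normalizer of $G$ in $AH$. $\mathrm{Aut}(G,\pi)$ is the set of group automorphisms $\varphi$ of $G$ that induce a permutation of $\pi$, i.e. for each $i$ there is $j$ with $\varphi(C_i)=C_j$. -}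

module Defs where

open import Data.Nat using (ℕ)
open import Data.Fin using (Fin)
open import Data.Product using (Σ; ∃; ∃-syntax; ∃₂; _×_; _,_; proj₁; proj₂)
open import Relation.Unary using (Pred)
open import Relation.Binary.PropositionalEquality using (_≡_)
open import Relation.Nullary using (¬_)
open import Function using (_∘_)
open import Function.Definitions using (Injective)
open import Algebra.Core using (Op₁; Op₂)

-- Everything is relative to a group (A, _∙_, ε, _⁻¹) whose equality is _≡_
-- and a finite family C : Fin ℓ → Pred A a of subsets (the collection π).
module Setup {a} {A : Set a} (_∙_ : Op₂ A) (ε : A) (_⁻¹ : Op₁ A)
             {ℓ : ℕ} (C : Fin ℓ → Pred A a) where

  _≐_ : Pred A a → Pred A a → Set a
  P ≐ Q = ∀ x → (P x → Q x) × (Q x → P x)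

  img : (A → A) → Pred A a → Pred A a
  img f P x = ∃[ y ] (P y × f y ≡ x)

  L : A → A → A
  L g x = g ∙ x

  _·_ : A → Pred A a → Pred A a
  g · P = img (L g) P

  HasSize : ℕ → Pred A a → Set a
  HasSize k P = Σ (Fin k → A) λ f →
    Injective _≡_ _≡_ f × (∀ j → P (f j)) × (∀ x → P x → ∃[ j ] f j ≡ x)

  Distinct : Set a
  Distinct = ∀ i j → ¬ i ≡ j → ¬ (C i ≐ C j)

  AllOfSize : ℕ → Set a
  AllOfSize k = ∀ i → HasSize k (C i)

  ContainE : Set a
  ContainE = ∀ i → C i ε

  PairwiseMeetInE : Set a
  PairwiseMeetInE = ∀ i j → ¬ i ≡ j → ∀ x → C i x → C j x → x ≡ ε

  TAxiom : Set a
  TAxiom = ∀ i s → C i s → ∃[ j ] (((s ⁻¹) · C i) ≐ C j)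

  -- hyperedges of CH(G,π) are the sets g · C i (g ∈ G, i < ℓ).
  -- σ (a permutation of G) maps the hyperedge set onto itself:
  -- the image of every hyperedge is a hyperedge, and every hyperedge is
  -- the image of a hyperedge (injectivity on hyperedges is automatic since
  -- σ is injective).
  MapsEdgesOntoEdges : (A → A) → Set a
  MapsEdgesOntoEdges σ =
    (∀ g i → ∃₂ λ h j → img σ (g · C i) ≐ (h · C j)) ×
    (∀ h j → ∃₂ λ g i → img σ (g · C i) ≐ (h · C j))

  record AH : Set a where
    field
      fun inv    : A → A
      inv-right  : ∀ x → fun (inv x) ≡ x
      inv-left   : ∀ x → inv (fun x) ≡ x
      edges      : MapsEdgesOntoEdges fun
  open AH public

  InG : (A → A) → Set a
  InG f = ∃[ h ] (∀ x → f x ≡ L h x)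

  InNormStab : AH → Set a
  InNormStab σ =
    (fun σ ε ≡ ε) ×
    (∀ g → InG (fun σ ∘ L g ∘ inv σ)) ×
    (∀ g → InG (inv σ ∘ L g ∘ fun σ))

  NormStab : Set a
  NormStab = Σ AH InNormStab

  nsFun : NormStab → A → A
  nsFun σ = fun (proj₁ σ)

  record AutGπ : Set a where
    field
      aut ainv   : A → A
      ainv-right : ∀ x → aut (ainv x) ≡ x
      ainv-left  : ∀ x → ainv (aut x) ≡ x
      hom        : ∀ x y → aut (x ∙ y) ≡ aut x ∙ aut y
      permutesπ  : ∀ i → ∃[ j ] (img aut (C i) ≐ C j)
  open AutGπ public

  -- pointwise equality of maps (the equality in both groups)
  _≈ₚ_ : (A → A) → (A → A) → Set a
  f ≈ₚ g = ∀ x → f x ≡ g x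

  -- isomorphism of groups (both with composition as operation):
  -- a well-defined bijection preserving composition
  record NormStab≅AutGπ : Set a where
    field
      Φ         : NormStab → AutGπ
      Φ-cong    : ∀ σ τ → nsFun σ ≈ₚ nsFun τ → aut (Φ σ) ≈ₚ aut (Φ τ)
      Φ-inj     : ∀ σ τ → aut (Φ σ) ≈ₚ aut (Φ τ) → nsFun σ ≈ₚ nsFun τ
      Φ-surj    : ∀ φ → ∃[ σ ] (aut (Φ σ) ≈ₚ aut φ)
      Φ-hom     : ∀ σ τ ρ → nsFun ρ ≈ₚ (nsFun σ ∘ nsFun τ) →
                  aut (Φ ρ) ≈ₚ (aut (Φ σ) ∘ aut (Φ τ))

-- An element σ of the normalizer of G in AH fixing e is a group automorphism:
-- σ L_x σ⁻¹ is some L_h, and evaluating at e (using σ e = e) forces h = σ x,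
-- i.e. σ(x y) = σ x · σ y.  It permutes π because σ(C) is a hyperedge h·C'
-- through σ e = e, and by the T-axiom every hyperedge through e lies in π.
-- Conversely an automorphism permuting π maps g·C to φ(g)·φ(C), and it hits
-- every hyperedge because the induced map on the finite index set is injective
-- (the C are distinct).  Both directions keep the underlying map, so the
-- isomorphism is the identity on maps.
module Submission where

open import Defs
open import Data.Nat using (ℕ; zero; suc)
open import Data.Nat.Properties using (1+n≰n)
open import Data.Fin using (Fin; punchOut)
open import Data.Fin.Properties using (_≟_; any?; punchOut-injective; injective⇒≤)
open import Data.Product using (∃-syntax; _,_; proj₁; proj₂)
open import Function using (_∘_)
open import Function.Definitions using (Injective)
open import Relation.Binary.PropositionalEquality
open import Relation.Nullary using (yes; no; contradiction)
open import Relation.Unary using (Pred)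
open import Algebra.Bundles using (Group)
open import Algebra.Core using (Op₁; Op₂)
open import Algebra.Structures using (IsGroup)
open import Algebra.Morphism.Consequences using (homomorphic₂-inv)
import Algebra.Morphism.Definitions as MorphismDefinitions
import Algebra.Properties.Group as GroupProperties

injective⇒surjective : ∀ {n} (f : Fin n → Fin n) → Injective _≡_ _≡_ f →
                       ∀ y → ∃[ x ] f x ≡ y
injective⇒surjective {zero}  f f-inj ()
injective⇒surjective {suc n} f f-inj y with any? (λ x → f x ≟ y)
... | yes hit = hit
... | no miss = contradiction (injective⇒≤ g-inj) 1+n≰n
  where
  y≢f : ∀ x → y ≢ f x
  y≢f x y≡fx = miss (x , sym y≡fx)

  g : Fin (suc n) → Fin n
  g x = punchOut (y≢f x)

  g-inj : Injective _≡_ _≡_ g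
  g-inj {x} {x′} eq = f-inj (punchOut-injective (y≢f x) (y≢f x′) eq)

module CayleyHypergraph {a} {A : Set a} (_∙_ : Op₂ A) (ε : A) (_⁻¹ : Op₁ A)
    (isGroup : IsGroup _≡_ _∙_ ε _⁻¹) {ℓ : ℕ} (C : Fin ℓ → Pred A a) where

  open Setup _∙_ ε _⁻¹ C
  open IsGroup isGroup using (identityˡ; identityʳ)
  open MorphismDefinitions A A _≡_ using (Homomorphic₂)

  group : Group a a
  group = record { isGroup = isGroup }

  open GroupProperties group using (inverseˡ-unique; identityˡ-unique)

  IsHom : (A → A) → Set a
  IsHom f = Homomorphic₂ f _∙_ _∙_

  ≐-sym : ∀ {P Q} → P ≐ Q → Q ≐ P
  ≐-sym P≐Q x = proj₂ (P≐Q x) , proj₁ (P≐Q x)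

  ≐-trans : ∀ {P Q R} → P ≐ Q → Q ≐ R → P ≐ R
  ≐-trans P≐Q Q≐R x = proj₁ (Q≐R x) ∘ proj₁ (P≐Q x) , proj₂ (P≐Q x) ∘ proj₂ (Q≐R x)

  img-cong : ∀ f {P Q} → P ≐ Q → img f P ≐ img f Q
  img-cong f P≐Q x = (λ { (y , Py , fy≡x) → y , proj₁ (P≐Q y) Py , fy≡x })
                   , (λ { (y , Qy , fy≡x) → y , proj₂ (P≐Q y) Qy , fy≡x })

  img-injective : ∀ {f} → Injective _≡_ _≡_ f →
                  ∀ {P Q} → img f P ≐ img f Q → P ≐ Q
  img-injective f-inj {P} {Q} fP≐fQ x =
      (λ Px → let (y , Qy , fy≡fx) = proj₁ (fP≐fQ _) (x , Px , refl)
              in subst Q (f-inj fy≡fx) Qy)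
    , (λ Qx → let (y , Py , fy≡fx) = proj₂ (fP≐fQ _) (x , Qx , refl)
              in subst P (f-inj fy≡fx) Py)

  ε·-identity : ∀ P → (ε · P) ≐ P
  ε·-identity P x = (λ { (y , Py , εy≡x) → subst P (trans (sym (identityˡ y)) εy≡x) Py })
                  , (λ Px → x , Px , identityˡ x)

  img-hom-· : ∀ {f} → IsHom f → ∀ g {P Q} → img f P ≐ Q → img f (g · P) ≐ (f g · Q)
  img-hom-· {f} f-hom g {P} {Q} fP≐Q x =
      (λ { (_ , (s , Ps , gs≡y) , fy≡x) →
            f s , proj₁ (fP≐Q (f s)) (s , Ps , refl) ,
            trans (sym (f-hom g s)) (trans (cong f gs≡y) fy≡x) })
    , (λ { (t , Qt , ft≡x) → let (s , Ps , fs≡t) = proj₂ (fP≐Q t) Qt in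
            g ∙ s , (s , Ps , refl) ,
            trans (f-hom g s) (trans (cong (f g ∙_) fs≡t) ft≡x) })

  hom⇒ε-preserving : ∀ {f} → IsHom f → f ε ≡ ε
  hom⇒ε-preserving {f} f-hom =
    identityˡ-unique (f ε) (f ε) (trans (sym (f-hom ε ε)) (cong f (identityˡ ε)))

  inverse-hom : ∀ {f g} → (∀ x → f (g x) ≡ x) → (∀ x → g (f x) ≡ x) → IsHom f → IsHom g
  inverse-hom {f} {g} fg≗id gf≗id =
    homomorphic₂-inv (Group.magma group) (Group.magma group) (cong g)
      ((λ { refl → fg≗id _ }) , (λ { refl → gf≗id _ }))

  normalizes-G⇒hom : ∀ {f g} → (∀ x → g (f x) ≡ x) → f ε ≡ ε →
                     (∀ x → InG (f ∘ L x ∘ g)) → IsHom f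
  normalizes-G⇒hom {f} {g} gf≗id fε≡ε conj x y = begin
    f (x ∙ y)        ≡⟨ cong (λ z → f (x ∙ z)) (sym (gf≗id y)) ⟩
    f (x ∙ g (f y))  ≡⟨ f∘Lx∘g≗Lh (f y) ⟩
    h ∙ f y          ≡⟨ cong (_∙ f y) h≡fx ⟩
    f x ∙ f y        ∎
    where
    open ≡-Reasoning
    h = proj₁ (conj x)
    f∘Lx∘g≗Lh = proj₂ (conj x)

    gε≡ε : g ε ≡ ε
    gε≡ε = trans (cong g (sym fε≡ε)) (gf≗id ε)

    h≡fx : h ≡ f x
    h≡fx = begin
      h            ≡⟨ sym (identityʳ h) ⟩
      h ∙ ε        ≡⟨ sym (f∘Lx∘g≗Lh ε) ⟩
      f (x ∙ g ε)  ≡⟨ cong (λ z → f (x ∙ z)) gε≡ε ⟩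
      f (x ∙ ε)    ≡⟨ cong f (identityʳ x) ⟩
      f x          ∎

  hom⇒normalizes-G : ∀ {f g} → (∀ x → f (g x) ≡ x) → IsHom f →
                     ∀ x → InG (f ∘ L x ∘ g)
  hom⇒normalizes-G {f} {g} fg≗id f-hom x =
    f x , λ y → trans (f-hom x (g y)) (cong (f x ∙_) (fg≗id y))

  module _ (ta : TAxiom) where

    edge∋ε⇒block : ∀ h j → (h · C j) ε → ∃[ j′ ] ((h · C j) ≐ C j′)
    edge∋ε⇒block h j (c , Cc , hc≡ε) with ta j c Cc
    ... | j′ , c⁻¹C≐C′ =
      j′ , subst (λ z → (z · C j) ≐ C j′) (sym (inverseˡ-unique h c hc≡ε)) c⁻¹C≐C′

    edge-preserving⇒permutes-blocks : ContainE → ∀ {f} → f ε ≡ ε →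
                                      MapsEdgesOntoEdges f →
                                      ∀ i → ∃[ j ] (img f (C i) ≐ C j)
    edge-preserving⇒permutes-blocks ce {f} fε≡ε (edges-to , _) i
      with h , j , fC≐hC ← edges-to ε i
      with j′ , hC≐C′ ← edge∋ε⇒block h j
                          (proj₁ (fC≐hC ε) (ε , (ε , ce i , identityˡ ε) , fε≡ε)) =
      j′ , ≐-trans (img-cong f (≐-sym (ε·-identity (C i)))) (≐-trans fC≐hC hC≐C′)

  module _ (distinct : Distinct) where

    block-image-injective : ∀ {f} → Injective _≡_ _≡_ f → (τ : Fin ℓ → Fin ℓ) →
                            (∀ i → img f (C i) ≐ C (τ i)) → Injective _≡_ _≡_ τ
    block-image-injective {f} f-inj τ fC≐Cτ {i} {i′} τi≡τi′ with i ≟ i′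
    ... | yes i≡i′ = i≡i′
    ... | no i≢i′ = contradiction (img-injective f-inj fCi≐fCi′) (distinct i i′ i≢i′)
      where
      fCi≐fCi′ : img f (C i) ≐ img f (C i′)
      fCi≐fCi′ = ≐-trans (fC≐Cτ i)
                   (≐-sym (subst (λ j → img f (C i′) ≐ C j) (sym τi≡τi′) (fC≐Cτ i′)))

    hom-permuting-blocks⇒edge-preserving :
      ∀ {f g} → (∀ x → f (g x) ≡ x) → (∀ x → g (f x) ≡ x) → IsHom f →
      (∀ i → ∃[ j ] (img f (C i) ≐ C j)) → MapsEdgesOntoEdges f
    hom-permuting-blocks⇒edge-preserving {f} {g} fg≗id gf≗id f-hom permutes =
        (λ h i → f h , τ i , img-hom-· f-hom h (fC≐Cτ i))
      , λ h j → let (i , τi≡j) = injective⇒surjective τ τ-inj j in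
          g h , i ,
          subst (λ z → img f (g h · C i) ≐ (z · C j)) (fg≗id h)
            (img-hom-· f-hom (g h) (subst (λ j → img f (C i) ≐ C j) τi≡j (fC≐Cτ i)))
      where
      τ : Fin ℓ → Fin ℓ
      τ i = proj₁ (permutes i)

      fC≐Cτ : ∀ i → img f (C i) ≐ C (τ i)
      fC≐Cτ i = proj₂ (permutes i)

      f-inj : Injective _≡_ _≡_ f
      f-inj {x} {y} fx≡fy = trans (sym (gf≗id x)) (trans (cong g fx≡fy) (gf≗id y))

      τ-inj : Injective _≡_ _≡_ τ
      τ-inj = block-image-injective f-inj τ fC≐Cτ

  normStab⇒autGπ : ContainE → TAxiom → NormStab → AutGπ
  normStab⇒autGπ ce ta (σ , σε≡ε , σGσ⁻¹⊆G , _) = record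
    { aut        = fun σ
    ; ainv       = inv σ
    ; ainv-right = inv-right σ
    ; ainv-left  = inv-left σ
    ; hom        = normalizes-G⇒hom (inv-left σ) σε≡ε σGσ⁻¹⊆G
    ; permutesπ  = edge-preserving⇒permutes-blocks ta ce σε≡ε (edges σ)
    }

  autGπ⇒normStab : Distinct → AutGπ → NormStab
  autGπ⇒normStab distinct φ = σ , hom⇒ε-preserving (hom φ)
                            , hom⇒normalizes-G (ainv-right φ) (hom φ)
                            , hom⇒normalizes-G (ainv-left φ) ainv-hom
    where
    ainv-hom : IsHom (ainv φ)
    ainv-hom = inverse-hom (ainv-right φ) (ainv-left φ) (hom φ)

    σ : AH
    σ = record
      { fun       = aut φ
      ; inv       = ainv φ
      ; inv-right = ainv-right φ
      ; inv-left  = ainv-left φ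
      ; edges     = hom-permuting-blocks⇒edge-preserving distinct
                      (ainv-right φ) (ainv-left φ) (hom φ) (permutesπ φ)
      }

theorem8p2 : ∀ {a} {A : Set a} (_∙_ : Op₂ A) (ε : A) (_⁻¹ : Op₁ A) →
    IsGroup _≡_ _∙_ ε _⁻¹ →
    (ℓ k : ℕ) (C : Fin ℓ → Pred A a) →
    Setup.Distinct _∙_ ε _⁻¹ C →
    Setup.AllOfSize _∙_ ε _⁻¹ C k →
    Setup.ContainE _∙_ ε _⁻¹ C →
    Setup.PairwiseMeetInE _∙_ ε _⁻¹ C →
    Setup.TAxiom _∙_ ε _⁻¹ C →
    Setup.NormStab≅AutGπ _∙_ ε _⁻¹ C
theorem8p2 _∙_ ε _⁻¹ isGroup ℓ k C distinct _ ce _ ta = record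
  { Φ      = normStab⇒autGπ ce ta
  ; Φ-cong = λ _ _ σ≈τ → σ≈τ
  ; Φ-inj  = λ _ _ σ≈τ → σ≈τ
  ; Φ-surj = λ φ → autGπ⇒normStab distinct φ , λ _ → refl
  ; Φ-hom  = λ _ _ _ ρ≈στ → ρ≈στ
  }
  where open CayleyHypergraph _∙_ ε _⁻¹ isGroup C
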